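{- Let $(D,r)$ be a rooted digraph and suppose there are two cut-edges $(x_1,y_1)$ and $(x_2,y_2)$ of $D$ such that $(x_1,x_2),(x_2,x_1)\in E(D)$. Let $D'$ be obtained from $D$ by contracting the arc $(x_1,x_2)$ (with root $r$). Then for every integer $k\ge 0$, $D$ has an outbranching rooted at $r$ with at least $k$ leaves if and only if $D'$ has an outbranching rooted at $r$ with at least $k$ leaves.
   Context: A rooted digraph $(D,r)$ is a finite digraph without loops or parallel arcs with a root $r$ of in-degree $0$. A cut-edge is an arc $e$ such that some vertex is not reachable from $r$ in $D-e$. An outbranching rooted at $r$ is a spanning subgraph whose underlying undirected graph is a tree with arcs oriented away from $r$; leaves are vertices of out-degree $0$ in it. Contracting an arc $(a,b)$ means identifying $a$ and $b$ into a new vertex, replacing $a$ and $b$ by it in all arcs, and deleting the resulting loops and parallel arcs. -}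

module Defs where

open import Data.Nat using (ℕ; suc)
open import Data.Fin using (Fin; punchOut; _≟_)
open import Data.Product using (Σ; ∃; _×_; _,_)
open import Relation.Nullary using (¬_; yes; no)
open import Relation.Binary.PropositionalEquality using (_≡_; _≢_; refl; sym; subst)
open import Function.Definitions using (Injective)

-- A digraph on vertex set Fin n is given by its arc relation (a relation, so
-- there are no parallel arcs).
Rel : ℕ → Set₁
Rel n = Fin n → Fin n → Set

Loopless : ∀ {n} → Rel n → Set
Loopless E = ∀ v → ¬ E v v

RootInDeg0 : ∀ {n} → Rel n → Fin n → Set
RootInDeg0 E r = ∀ u → ¬ E u r

data Reach {n} (A : Rel n) (r : Fin n) : Fin n → Set where
  here : Reach A r r
  step : ∀ {u v} → Reach A r u → A u v → Reach A r v

deleteArc : ∀ {n} → Rel n → Fin n → Fin n → Rel n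
deleteArc E a b u w = E u w × ¬ ((u ≡ a) × (w ≡ b))

CutEdge : ∀ {n} → Rel n → Fin n → Fin n → Fin n → Set
CutEdge E r a b = E a b × ∃ λ v → ¬ Reach (deleteArc E a b) r v

-- B is an outbranching of (E , r): a spanning subgraph in which every vertex is
-- reachable from r and every vertex has in-degree at most one (r has in-degree 0),
-- i.e. a spanning tree whose arcs are oriented away from r.
IsOutbranching : ∀ {n} → Rel n → Fin n → Rel n → Set
IsOutbranching E r B =
  (∀ u v → B u v → E u v) ×
  (∀ v → Reach B r v) ×
  (∀ u → ¬ B u r) ×
  (∀ a b v → B a v → B b v → a ≡ b)

IsLeaf : ∀ {n} → Rel n → Fin n → Set
IsLeaf B v = ∀ w → ¬ B v w

AtLeastLeaves : ∀ {n} → Rel n → ℕ → Set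
AtLeastLeaves {n} B k =
  Σ (Fin k → Fin n) λ f → Injective _≡_ _≡_ f × (∀ i → IsLeaf B (f i))

HasOutbranchingLeaves : ∀ {n} → Rel n → Fin n → ℕ → Set₁
HasOutbranchingLeaves E r k = Σ (Rel _) λ B → IsOutbranching E r B × AtLeastLeaves B k

arc-distinct : ∀ {n} {E : Rel n} → Loopless E → ∀ {a b} → E a b → a ≢ b
arc-distinct loop {a} e refl = loop a e

-- Contraction of the arc (x1,x2) in a digraph on Fin (suc m): the vertex set of
-- the result is Fin m, obtained by deleting x2 and renumbering (punchOut);
-- x1 and x2 are both sent to the image of x1, every other vertex to itself.
contractMap : ∀ {m} (x1 x2 : Fin (suc m)) → x1 ≢ x2 → Fin (suc m) → Fin m
contractMap x1 x2 ne j with j ≟ x2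
... | yes _   = punchOut {i = x2} {j = x1} (λ eq → ne (sym eq))
... | no j≢x2 = punchOut {i = x2} {j = j} (λ eq → j≢x2 (sym eq))

-- arcs of the contracted digraph: images of arcs, with loops deleted
-- (parallel arcs disappear automatically since arcs form a relation)
contractArcs : ∀ {m} (E : Rel (suc m)) (x1 x2 : Fin (suc m)) → x1 ≢ x2 → Rel m
contractArcs E x1 x2 ne u w =
  (u ≢ w) ×
  ∃ λ a → ∃ λ b → (contractMap x1 x2 ne a ≡ u) × (contractMap x1 x2 ne b ≡ w) × E a b

{-# OPTIONS --safe #-}
-- Every outbranching contains every cut-edge, so x1 and x2 are inner vertices of it. Whichever
-- of x1, x2 is reached first from r can adopt the other as a child (via x1x2 or x2x1) without
-- creating leaves; contracting the arc between them then keeps all leaves, which lie outside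
-- {x1, x2}. Conversely, an outbranching of D' lifts to D by realising each of its arcs by an arc
-- of D: the merged vertex is entered at one of x1, x2 and the other one hangs below it, so every
-- leaf of D' has a leaf of D above it.
module Submission where

open import Defs
open import Data.Nat using (ℕ; suc)
open import Data.Fin using (Fin; _≟_; punchOut; punchIn)
open import Data.Fin.Properties using (punchOut-injective; punchOut-cong; punchOut-punchIn; punchInᵢ≢i)
open import Data.Maybe using (Maybe; just; nothing)
open import Data.Maybe.Properties using (just-injective)
open import Data.Product using (∃; _×_; _,_; proj₁; proj₂)
open import Data.Sum using (_⊎_; inj₁; inj₂; [_,_]′; swap; map₂)
open import Data.Empty using (⊥-elim)
open import Relation.Nullary using (¬_; yes; no)
open import Relation.Binary.PropositionalEquality
open import Function using (_∘_)
open import Function.Bundles using (_⇔_; mk⇔)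

Reach-mono : ∀ {n} {A A′ : Rel n} {r v} → (∀ {u w} → A u w → A′ u w) → Reach A r v → Reach A′ r v
Reach-mono f here       = here
Reach-mono f (step ρ a) = step (Reach-mono f ρ) (f a)

Avoid : ∀ {n} → Rel n → Fin n → Rel n
Avoid B x u w = B u w × w ≢ x

first-reached : ∀ {n} {B : Rel n} {r x y} → x ≢ y → Reach B r x →
                Reach (Avoid B y) r x ⊎ Reach (Avoid B x) r y
first-reached {B = B} {r} {x} {y} x≢y ρ =
  [ inj₁ , [ inj₂ , inj₁ ∘ Reach-mono forget-x ]′ ]′ (go ρ)
  where
  forget-x : ∀ {u w} → Avoid (Avoid B x) y u w → Avoid B y u w
  forget-x ((b , _) , w≢y) = b , w≢y

  go : ∀ {v} → Reach B r v →
       Reach (Avoid B y) r x ⊎ Reach (Avoid B x) r y ⊎ Reach (Avoid (Avoid B x) y) r v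
  go here = inj₂ (inj₂ here)
  go (step {_} {w} ρ b) with go ρ
  ... | inj₁ ρx        = inj₁ ρx
  ... | inj₂ (inj₁ ρy) = inj₂ (inj₁ ρy)
  ... | inj₂ (inj₂ ρ′) with w ≟ x | w ≟ y
  ... | yes refl | _        = inj₁ (step (Reach-mono forget-x ρ′) (b , x≢y))
  ... | no _     | yes refl = inj₂ (inj₁ (step (Reach-mono proj₁ ρ′) (b , x≢y ∘ sym)))
  ... | no w≢x   | no w≢y   = inj₂ (inj₂ (step ρ′ ((b , w≢x) , w≢y)))

arc-used-or-Reach-deleteArc : ∀ {n} {E B : Rel n} {r a b v} → (∀ u w → B u w → E u w) →
                              Reach B r v → B a b ⊎ Reach (deleteArc E a b) r v
arc-used-or-Reach-deleteArc sub here = inj₂ here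
arc-used-or-Reach-deleteArc {a = a} {b} sub (step {u} {w} ρ q) with arc-used-or-Reach-deleteArc sub ρ
... | inj₁ bab = inj₁ bab
... | inj₂ ρ′ with u ≟ a | w ≟ b
... | yes refl | yes refl = inj₁ q
... | yes _    | no w≢b   = inj₂ (step ρ′ (sub u w q , w≢b ∘ proj₂))
... | no u≢a   | _        = inj₂ (step ρ′ (sub u w q , u≢a ∘ proj₁))

outbranching-contains-cutEdge : ∀ {n} {E B : Rel n} {r a b} →
                                IsOutbranching E r B → CutEdge E r a b → B a b
outbranching-contains-cutEdge (sub , reach , _) (_ , v , unreachable)
  with arc-used-or-Reach-deleteArc sub (reach v)
... | inj₁ bab = bab
... | inj₂ ρ   = ⊥-elim (unreachable ρ)

redirect : ∀ {n} → Rel n → Fin n → Fin n → Rel n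
redirect B x y u w = Avoid B y u w ⊎ (u ≡ x × w ≡ y)

redirect-outbranching : ∀ {n} {E B : Rel n} {r x y} → RootInDeg0 E r → E x y →
                        Reach (Avoid B y) r x → IsOutbranching E r B →
                        IsOutbranching E r (redirect B x y)
redirect-outbranching {E = E} {B} {r} {x} {y} rootE exy ρx (sub , reach , root , unique) =
  sub′ , (λ v → reach′ (reach v)) , root′ , unique′
  where
  sub′ : ∀ u w → redirect B x y u w → E u w
  sub′ u w (inj₁ (b , _))        = sub u w b
  sub′ _ _ (inj₂ (refl , refl)) = exy

  reach′ : ∀ {v} → Reach B r v → Reach (redirect B x y) r v
  reach′ here = here
  reach′ (step {_} {w} ρ b) with w ≟ y
  ... | yes refl = step (Reach-mono inj₁ ρx) (inj₂ (refl , refl))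
  ... | no w≢y   = step (reach′ ρ) (inj₁ (b , w≢y))

  root′ : ∀ u → ¬ redirect B x y u r
  root′ u (inj₁ (b , _))        = root u b
  root′ _ (inj₂ (refl , refl)) = rootE x exy

  unique′ : ∀ a b v → redirect B x y a v → redirect B x y b v → a ≡ b
  unique′ a b v (inj₁ (p , _))      (inj₁ (q , _))      = unique a b v p q
  unique′ _ _ _ (inj₁ (_ , v≢y))    (inj₂ (_ , v≡y))    = ⊥-elim (v≢y v≡y)
  unique′ _ _ _ (inj₂ (_ , v≡y))    (inj₁ (_ , v≢y))    = ⊥-elim (v≢y v≡y)
  unique′ _ _ _ (inj₂ (refl , _))   (inj₂ (refl , _))   = refl

redirect-leaf : ∀ {n} {B : Rel n} {x y z v} → B x z → IsLeaf B v → IsLeaf (redirect B x y) v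
redirect-leaf bxz leaf w (inj₁ (b , _))    = leaf w b
redirect-leaf bxz leaf _ (inj₂ (refl , _)) = leaf _ bxz

OneOf : ∀ {n} → Fin n → Fin n → Fin n → Set
OneOf x y u = u ≡ x ⊎ u ≡ y

merged-arc : ∀ {n} {E : Rel n} {x y u w} → E x y → E y x →
             OneOf x y u → OneOf x y w → u ≢ w → E u w
merged-arc exy eyx (inj₁ refl) (inj₁ refl) u≢w = ⊥-elim (u≢w refl)
merged-arc exy eyx (inj₁ refl) (inj₂ refl) u≢w = exy
merged-arc exy eyx (inj₂ refl) (inj₁ refl) u≢w = eyx
merged-arc exy eyx (inj₂ refl) (inj₂ refl) u≢w = ⊥-elim (u≢w refl)

root-not-merged : ∀ {n} {E : Rel n} {r x y} → RootInDeg0 E r → E x y → E y x → ¬ OneOf x y r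
root-not-merged rootE exy eyx (inj₁ refl) = rootE _ eyx
root-not-merged rootE exy eyx (inj₂ refl) = rootE _ exy

record Merges {n n′} (c : Fin n → Fin n′) (x y : Fin n) : Set where
  field
    distinct   : x ≢ y
    merged     : c x ≡ c y
    fibre      : ∀ {u w} → c u ≡ c w → u ≡ w ⊎ (OneOf x y u × OneOf x y w)
    surjective : ∀ v′ → ∃ λ v → c v ≡ v′

  alone : ∀ {v w} → ¬ OneOf x y v → c w ≡ c v → w ≡ v
  alone v∉ cw≡cv with fibre cw≡cv
  ... | inj₁ w≡v      = w≡v
  ... | inj₂ (_ , v∈) = ⊥-elim (v∉ v∈)

  partner-or-alone : ∀ b → (∃ λ v → c v ≡ c b × v ≢ b) ⊎ (∀ {w} → c w ≡ c b → w ≡ b)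
  partner-or-alone b with b ≟ x | b ≟ y
  ... | yes refl | _        = inj₁ (y , sym merged , distinct ∘ sym)
  ... | no _     | yes refl = inj₁ (x , merged , distinct)
  ... | no b≢x   | no b≢y   = inj₂ (alone [ b≢x , b≢y ]′)

Merges-sym : ∀ {n n′} {c : Fin n → Fin n′} {x y} → Merges c x y → Merges c y x
Merges-sym m = record
  { distinct   = distinct ∘ sym
  ; merged     = sym merged
  ; fibre      = λ eq → map₂ (λ { (u∈ , w∈) → swap u∈ , swap w∈ }) (fibre eq)
  ; surjective = surjective
  }
  where open Merges m

imageArcs : ∀ {n n′} → (Fin n → Fin n′) → Rel n → Rel n′
imageArcs c E u w = (u ≢ w) × ∃ λ a → ∃ λ b → (c a ≡ u) × (c b ≡ w) × E a b

Reach-image : ∀ {n n′} (c : Fin n → Fin n′) {B : Rel n} {r v} →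
              Reach B r v → Reach (imageArcs c B) (c r) (c v)
Reach-image c here = here
Reach-image c {r = r} (step {u} {w} ρ b) with c u ≟ c w
... | yes cu≡cw = subst (Reach _ (c r)) cu≡cw (Reach-image c ρ)
... | no cu≢cw  = step (Reach-image c ρ) (cu≢cw , u , w , refl , refl , b)

module _ {n n′} {c : Fin n → Fin n′} {x y : Fin n} (merge : Merges c x y) where
  open Merges merge

  image-outbranching : ∀ {E B : Rel n} {r} → ¬ OneOf x y r → IsOutbranching E r B → B x y →
                       IsOutbranching (imageArcs c E) (c r) (imageArcs c B)
  image-outbranching {E} {B} {r} r∉ (sub , reach , root , unique) bxy =
    sub′ , reach′ , root′ , unique′
    where
    sub′ : ∀ u w → imageArcs c B u w → imageArcs c E u w
    sub′ u w (ne , a , b , ca , cb , q) = ne , a , b , ca , cb , sub a b q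

    reach′ : ∀ v′ → Reach (imageArcs c B) (c r) v′
    reach′ v′ with surjective v′
    ... | v , refl = Reach-image c (reach v)

    root′ : ∀ u′ → ¬ imageArcs c B u′ (c r)
    root′ _ (_ , a , b , _ , cb≡cr , q) = root a (subst (B a) (alone r∉ cb≡cr) q)

    -- (x , y) is the only arc of B entering y, and it is contracted.
    enters-at-x : ∀ {a b} → OneOf x y b → B a b → c a ≢ c b → b ≡ x
    enters-at-x (inj₁ b≡x)   _ _     = b≡x
    enters-at-x (inj₂ refl) q ca≢cb = ⊥-elim (ca≢cb (trans (cong c (unique _ x y q bxy)) merged))

    same-head : ∀ {a₁ b₁ a₂ b₂} → B a₁ b₁ → B a₂ b₂ → c a₁ ≢ c b₁ → c a₂ ≢ c b₂ →
                c b₁ ≡ c b₂ → b₁ ≡ b₂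
    same-head q₁ q₂ ne₁ ne₂ cb₁≡cb₂ with fibre cb₁≡cb₂
    ... | inj₁ b₁≡b₂       = b₁≡b₂
    ... | inj₂ (b₁∈ , b₂∈) = trans (enters-at-x b₁∈ q₁ ne₁) (sym (enters-at-x b₂∈ q₂ ne₂))

    unique′ : ∀ u₁ u₂ w → imageArcs c B u₁ w → imageArcs c B u₂ w → u₁ ≡ u₂
    unique′ _ _ _ (ne₁ , a₁ , b₁ , refl , refl , q₁) (ne₂ , a₂ , b₂ , refl , cb₂ , q₂)
      with same-head q₁ q₂ ne₁ (ne₂ ∘ (λ e → trans e cb₂)) (sym cb₂)
    ... | refl = cong c (unique a₁ a₂ b₁ q₁ q₂)

  image-leaf : ∀ {B : Rel n} {v} → ¬ OneOf x y v → IsLeaf B v → IsLeaf (imageArcs c B) (c v)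
  image-leaf {B} v∉ leaf _ (_ , a , b , ca≡cv , _ , q) = leaf b (subst (λ z → B z b) (alone v∉ ca≡cv) q)

  image-leaves : ∀ {B : Rel n} {k} → (∀ {s} → OneOf x y s → ¬ IsLeaf B s) →
                 AtLeastLeaves B k → AtLeastLeaves (imageArcs c B) k
  image-leaves busy (f , f-inj , f-leaf) =
    c ∘ f , (λ {i} {j} eq → f-inj (alone (f∉ j) eq)) , λ i → image-leaf (f∉ i) (f-leaf i)
    where
    f∉ : ∀ i → ¬ OneOf x y (f i)
    f∉ i s = busy s (f-leaf i)

  contract-outbranching : ∀ {E B : Rel n} {r x′ y′ k} → Loopless E → RootInDeg0 E r →
                          ¬ OneOf x y r → E x y → IsOutbranching E r B → Reach (Avoid B y) r x →
                          B x x′ → B y y′ → AtLeastLeaves B k →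
                          HasOutbranchingLeaves (imageArcs c E) (c r) k
  contract-outbranching {B = B} {y′ = y′} loop rootE r∉ exy ob ρx bxx′ byy′ (f , f-inj , f-leaf) =
    imageArcs c (redirect B x y) ,
    image-outbranching r∉ (redirect-outbranching rootE exy ρx ob) (inj₂ (refl , refl)) ,
    image-leaves busy (f , f-inj , λ i → redirect-leaf {B = B} {y = y} bxx′ (f-leaf i))
    where
    busy : ∀ {s} → OneOf x y s → ¬ IsLeaf (redirect B x y) s
    busy (inj₁ refl) leaf = leaf y (inj₂ (refl , refl))
    busy (inj₂ refl) leaf = leaf y′ (inj₁ (byy′ , arc-distinct loop (proj₁ ob y y′ byy′) ∘ sym))

leaves-from-preimages : ∀ {n n′} (c : Fin n → Fin n′) {B : Rel n} {B′ : Rel n′} {k} →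
                        (∀ {v′} → IsLeaf B′ v′ → ∃ λ v → c v ≡ v′ × IsLeaf B v) →
                        AtLeastLeaves B′ k → AtLeastLeaves B k
leaves-from-preimages {n} c {k = k} preimage (f , f-inj , f-leaf) =
  g , (λ {i} {j} eq → f-inj (trans (sym (lies-over i)) (trans (cong c eq) (lies-over j)))) ,
  proj₂ ∘ proj₂ ∘ preimage ∘ f-leaf
  where
  g : Fin k → Fin n
  g = proj₁ ∘ preimage ∘ f-leaf
  lies-over : ∀ i → c (g i) ≡ f i
  lies-over = proj₁ ∘ proj₂ ∘ preimage ∘ f-leaf

module Lift {n n′} {c : Fin n → Fin n′} {x y : Fin n} (merge : Merges c x y)
            {E : Rel n} {r : Fin n} (r∉ : ¬ OneOf x y r) (exy : E x y) (eyx : E y x)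
            {B′ : Rel n′} (sub′ : ∀ u′ v′ → B′ u′ v′ → imageArcs c E u′ v′)
            (reach′ : ∀ v′ → Reach B′ (c r) v′) (root′ : ∀ u′ → ¬ B′ u′ (c r))
            (unique′ : ∀ a b v′ → B′ a v′ → B′ b v′ → a ≡ b) where
  open Merges merge

  record Entry (v′ : Fin n′) (a b : Fin n) : Set where
    field
      lands-in : c b ≡ v′
      arc      : E a b
      parent   : B′ (c a) v′
  open Entry

  lastArc : ∀ {v′} → Reach B′ (c r) v′ → Maybe (Fin n × Fin n)
  lastArc here = nothing
  lastArc (step {u′} {v′} _ q) with sub′ u′ v′ q
  ... | _ , a , b , _ = just (a , b)

  lastArc-nothing : ∀ {v′} (ρ : Reach B′ (c r) v′) → lastArc ρ ≡ nothing → v′ ≡ c r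
  lastArc-nothing here _ = refl
  lastArc-nothing (step _ _) ()

  lastArc-just : ∀ {v′ a b} (ρ : Reach B′ (c r) v′) → lastArc ρ ≡ just (a , b) → Entry v′ a b
  lastArc-just (step {u′} {v′} _ q) eq with sub′ u′ v′ q
  lastArc-just (step _ q) refl | _ , a , b , refl , cb , eab =
    record { lands-in = cb ; arc = eab ; parent = q }

  -- B′ is not decidable, so the arc of D realising the arc of B′ into v′ is read off the last
  -- step of the path reach′ v′.
  entry : Fin n′ → Maybe (Fin n × Fin n)
  entry v′ = lastArc (reach′ v′)

  entry-nothing : ∀ {v′} → entry v′ ≡ nothing → v′ ≡ c r
  entry-nothing = lastArc-nothing (reach′ _)

  entry-just : ∀ {v′ a b} → entry v′ ≡ just (a , b) → Entry v′ a b
  entry-just = lastArc-just (reach′ _)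

  -- The class of v is entered through its recorded arc (a , b); the other vertex of a
  -- two-vertex class hangs below b.
  Lifted : Rel n
  Lifted u v = entry (c v) ≡ just (u , v) ⊎ (v ≢ u × ∃ λ a → entry (c v) ≡ just (a , u))

  Lifted⊆E : ∀ u v → Lifted u v → E u v
  Lifted⊆E u v (inj₁ eq) = arc (entry-just eq)
  Lifted⊆E u v (inj₂ (v≢u , a , eq)) with fibre (lands-in (entry-just eq))
  ... | inj₁ u≡v        = ⊥-elim (v≢u (sym u≡v))
  ... | inj₂ (u∈ , v∈) = merged-arc exy eyx u∈ v∈ (v≢u ∘ sym)

  Lifted-root : ∀ u → ¬ Lifted u r
  Lifted-root u (inj₁ eq)           = root′ (c u) (parent (entry-just eq))
  Lifted-root u (inj₂ (_ , a , eq)) = root′ (c a) (parent (entry-just eq))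

  Lifted-unique : ∀ a b v → Lifted a v → Lifted b v → a ≡ b
  Lifted-unique a b v (inj₁ p) (inj₁ q) =
    cong proj₁ (just-injective (trans (sym p) q))
  Lifted-unique a b v (inj₁ p) (inj₂ (v≢b , _ , q)) =
    ⊥-elim (v≢b (cong proj₂ (just-injective (trans (sym p) q))))
  Lifted-unique a b v (inj₂ (v≢a , _ , p)) (inj₁ q) =
    ⊥-elim (v≢a (cong proj₂ (just-injective (trans (sym q) p))))
  Lifted-unique a b v (inj₂ (_ , _ , p)) (inj₂ (_ , _ , q)) =
    cong proj₂ (just-injective (trans (sym p) q))

  Reach-lift : ∀ {v′} → Reach B′ (c r) v′ → ∀ v → c v ≡ v′ → Reach Lifted r v
  Reach-lift here v cv≡cr = subst (Reach Lifted r) (sym (alone r∉ cv≡cr)) here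
  Reach-lift (step {u′} ρ q) v refl with entry (c v) in eq
  ... | nothing = ⊥-elim (root′ u′ (subst (B′ u′) (entry-nothing eq) q))
  ... | just (a , b)
    with Reach-lift ρ a (unique′ (c a) u′ (c v) (parent (entry-just eq)) q) | v ≟ b
  ... | ρa | yes refl = step ρa (inj₁ eq)
  ... | ρa | no v≢b   =
    step (step ρa (inj₁ (trans (cong entry (lands-in (entry-just eq))) eq))) (inj₂ (v≢b , a , eq))

  Lifted-outbranching : IsOutbranching E r Lifted
  Lifted-outbranching =
    Lifted⊆E , (λ v → Reach-lift (reach′ (c v)) v refl) , Lifted-root , Lifted-unique

  Lifted-leaf : ∀ {v v′} → c v ≡ v′ → IsLeaf B′ v′ →
                (∀ {a w} → entry v′ ≡ just (a , v) → c w ≡ c v → w ≡ v) → IsLeaf Lifted v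
  Lifted-leaf refl leaf′ _ w (inj₁ eq) = leaf′ (c w) (parent (entry-just eq))
  Lifted-leaf {v} refl leaf′ entered-alone w (inj₂ (w≢v , a , eq)) =
    w≢v (entered-alone (trans (cong entry cv≡cw) eq) (sym cv≡cw))
    where
    cv≡cw : c v ≡ c w
    cv≡cw = lands-in (entry-just eq)

  lift-leaf : ∀ {v′} → IsLeaf B′ v′ → ∃ λ v → c v ≡ v′ × IsLeaf Lifted v
  lift-leaf {v′} leaf′ with entry v′ in eq
  ... | nothing = r , cr≡v′ , Lifted-leaf cr≡v′ leaf′ (λ _ → alone r∉)
    where
    cr≡v′ : c r ≡ v′
    cr≡v′ = sym (entry-nothing eq)
  ... | just (a , b) with partner-or-alone b
  ...   | inj₂ b-alone = b , cb≡v′ , Lifted-leaf cb≡v′ leaf′ (λ _ → b-alone)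
    where
    cb≡v′ : c b ≡ v′
    cb≡v′ = lands-in (entry-just eq)
  ...   | inj₁ (v , cv≡cb , v≢b) = v , cv≡v′ , Lifted-leaf cv≡v′ leaf′ entered-at-b
    where
    cv≡v′ : c v ≡ v′
    cv≡v′ = trans cv≡cb (lands-in (entry-just eq))

    entered-at-b : ∀ {a′ w} → entry v′ ≡ just (a′ , v) → c w ≡ c v → w ≡ v
    entered-at-b eq′ _ = ⊥-elim (v≢b (cong proj₂ (just-injective (trans (sym eq′) eq))))

lift-outbranching : ∀ {n n′} {c : Fin n → Fin n′} {x y : Fin n} → Merges c x y →
                    ∀ {E : Rel n} {r k} → RootInDeg0 E r → E x y → E y x →
                    HasOutbranchingLeaves (imageArcs c E) (c r) k → HasOutbranchingLeaves E r k
lift-outbranching {c = c} merge {E} rootE exy eyx (B′ , (sub′ , reach′ , root′ , unique′) , leaves′) =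
  Lifted , Lifted-outbranching , leaves-from-preimages c lift-leaf leaves′
  where open Lift merge (root-not-merged {E = E} rootE exy eyx) exy eyx sub′ reach′ root′ unique′

contractMap-merges : ∀ {m} {x1 x2 : Fin (suc m)} (x1≢x2 : x1 ≢ x2) →
                     Merges (contractMap x1 x2 x1≢x2) x1 x2
contractMap-merges {m} {x1} {x2} x1≢x2 = record
  { distinct   = x1≢x2
  ; merged     = merged
  ; fibre      = fibre
  ; surjective = surjective
  }
  where
  cm : Fin (suc m) → Fin m
  cm = contractMap x1 x2 x1≢x2

  merged : cm x1 ≡ cm x2
  merged with x1 ≟ x2 | x2 ≟ x2
  ... | yes x1≡x2 | _     = ⊥-elim (x1≢x2 x1≡x2)
  ... | no _      | yes _ = punchOut-cong x2 refl
  ... | no _      | no ne = ⊥-elim (ne refl)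

  fibre : ∀ {u w} → cm u ≡ cm w → u ≡ w ⊎ (OneOf x1 x2 u × OneOf x1 x2 w)
  fibre {u} {w} eq with u ≟ x2 | w ≟ x2
  ... | yes u≡x2 | yes w≡x2 = inj₁ (trans u≡x2 (sym w≡x2))
  ... | yes u≡x2 | no w≢x2  = inj₂ (inj₂ u≡x2 , inj₁ (sym (punchOut-injective (x1≢x2 ∘ sym) (w≢x2 ∘ sym) eq)))
  ... | no u≢x2  | yes w≡x2 = inj₂ (inj₁ (punchOut-injective (u≢x2 ∘ sym) (x1≢x2 ∘ sym) eq) , inj₂ w≡x2)
  ... | no u≢x2  | no w≢x2  = inj₁ (punchOut-injective (u≢x2 ∘ sym) (w≢x2 ∘ sym) eq)

  cm-punchIn : ∀ v′ → cm (punchIn x2 v′) ≡ v′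
  cm-punchIn v′ with punchIn x2 v′ ≟ x2
  ... | yes eq = ⊥-elim (punchInᵢ≢i x2 v′ eq)
  ... | no _   = trans (punchOut-cong x2 refl) (punchOut-punchIn x2)

  surjective : ∀ v′ → ∃ λ v → cm v ≡ v′
  surjective v′ = punchIn x2 v′ , cm-punchIn v′

lemma8 : ∀ {m} (E : Rel (suc m)) (r x1 y1 x2 y2 : Fin (suc m))
         (loop : Loopless E) → RootInDeg0 E r →
         CutEdge E r x1 y1 → CutEdge E r x2 y2 →
         (e12 : E x1 x2) → E x2 x1 → (k : ℕ) →
         HasOutbranchingLeaves E r k ⇔
         HasOutbranchingLeaves (contractArcs E x1 x2 (arc-distinct loop e12))
                               (contractMap x1 x2 (arc-distinct loop e12) r) k
lemma8 E r x1 y1 x2 y2 loop rootE cut1 cut2 e12 e21 k =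
  mk⇔ forward (lift-outbranching merge rootE e12 e21)
  where
  x1≢x2 : x1 ≢ x2
  x1≢x2 = arc-distinct loop e12

  merge : Merges (contractMap x1 x2 x1≢x2) x1 x2
  merge = contractMap-merges x1≢x2

  r∉ : ¬ OneOf x1 x2 r
  r∉ = root-not-merged rootE e12 e21

  forward : HasOutbranchingLeaves E r k →
            HasOutbranchingLeaves (contractArcs E x1 x2 x1≢x2) (contractMap x1 x2 x1≢x2 r) k
  forward (B , ob , leaves) =
    [ (λ ρ → contract-outbranching merge loop rootE r∉ e12 ob ρ b1 b2 leaves)
    , (λ ρ → contract-outbranching (Merges-sym merge) loop rootE (r∉ ∘ swap) e21 ob ρ b2 b1 leaves)
    ]′ (first-reached x1≢x2 (proj₁ (proj₂ ob) x1))
    where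
    b1 : B x1 y1
    b1 = outbranching-contains-cutEdge ob cut1
    b2 : B x2 y2
    b2 = outbranching-contains-cutEdge ob cut2
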